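{- There is no function $f\colon \mathbb{N}\to\mathbb{N}$ such that $\chi_{\mathrm{so}}(G)\leq f(\chi_{\mathrm{o}}(G))$ for all graphs $G$.
   Context: All graphs are finite and simple. A proper vertex-coloring $\varphi\colon V(G)\to[t]$ of a graph $G$ is \emph{strong odd} if for every vertex $v\in V(G)$ and every color $i\in[t]$ the number $|N(v)\cap\varphi^{ -1}(i)|$ is either zero or odd; $\chi_{\mathrm{so}}(G)$ (the strong odd chromatic number) is the minimum $t$ such that $G$ has a strong odd coloring with $t$ colors. A proper vertex-coloring is \emph{odd} if in the neighborhood of every non-isolated vertex some color appears an odd number of times; $\chi_{\mathrm{o}}(G)$ (the odd chromatic number) is the minimum number of colors in an odd coloring of $G$. -}

module Defs where

open import Data.Nat using (ℕ; zero; suc; _+_; _≤_; _%_)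
open import Data.Fin using (Fin; _≟_)
open import Data.Bool using (Bool; true; false; _∧_; if_then_else_)
open import Data.List using (List; map; allFin)
open import Data.Nat.ListAction using (sum)
open import Data.Product using (Σ; ∃; _×_)
open import Data.Sum using (_⊎_)
open import Relation.Nullary using (¬_)
open import Relation.Nullary.Decidable using (⌊_⌋)
open import Relation.Binary.PropositionalEquality using (_≡_; _≢_)

record Graph : Set where
  field
    n      : ℕ
    adj    : Fin n → Fin n → Bool
    sym    : ∀ u v → adj u v ≡ adj v u
    irrefl : ∀ v → adj v v ≡ false

open Graph public

count : (n : ℕ) → (Fin n → Bool) → ℕ
count n p = sum (map (λ u → if p u then 1 else 0) (allFin n))

IsOdd : ℕ → Set
IsOdd m = m % 2 ≡ 1

module _ (G : Graph) where

  nbColorCount : {t : ℕ} → (Fin (n G) → Fin t) → Fin (n G) → Fin t → ℕ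
  nbColorCount φ v i = count (n G) (λ u → adj G v u ∧ ⌊ φ u ≟ i ⌋)

  IsProper : {t : ℕ} → (Fin (n G) → Fin t) → Set
  IsProper φ = ∀ u v → adj G u v ≡ true → φ u ≢ φ v

  IsStrongOdd : {t : ℕ} → (Fin (n G) → Fin t) → Set
  IsStrongOdd {t} φ = IsProper φ ×
    (∀ v (i : Fin t) → nbColorCount φ v i ≡ 0 ⊎ IsOdd (nbColorCount φ v i))

  IsOddColoring : {t : ℕ} → (Fin (n G) → Fin t) → Set
  IsOddColoring {t} φ = IsProper φ ×
    (∀ v → (∃ λ u → adj G v u ≡ true) → ∃ λ (i : Fin t) → IsOdd (nbColorCount φ v i))

  HasStrongOddColoring : ℕ → Set
  HasStrongOddColoring t = ∃ λ (φ : Fin (n G) → Fin t) → IsStrongOdd φ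

  HasOddColoring : ℕ → Set
  HasOddColoring t = ∃ λ (φ : Fin (n G) → Fin t) → IsOddColoring φ

  IsStrongOddChromaticNumber : ℕ → Set
  IsStrongOddChromaticNumber k =
    HasStrongOddColoring k × (∀ t → HasStrongOddColoring t → k ≤ t)

  IsOddChromaticNumber : ℕ → Set
  IsOddChromaticNumber k =
    HasOddColoring k × (∀ t → HasOddColoring t → k ≤ t)

-- Take hubs h₀ … h_{N-1}, each with a pendant leaf, and for every pair (x , y) an edge
-- link–guard both of whose ends are joined to h_x and h_y.  Colouring hubs, links, guards and
-- leaves with four colours is odd: the partner of a vertex (hub ↔ leaf, link ↔ guard) is its
-- only neighbour of that colour.  In a strong odd colouring two hubs h_x, h_y with x ≢ y get
-- different colours, for otherwise the link of (x , y) would see exactly two vertices of their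
-- colour; the guard cannot be a third one, being adjacent to h_x.  So χ_o ≤ 4 and χ_so ≥ N.

module Submission where

open import Data.Bool using (Bool; true; false; not; _∧_; _∨_; _xor_; if_then_else_)
open import Data.Bool.Properties using (∧-conicalˡ; ∧-conicalʳ; ∨-zeroʳ; xor-comm; xor-same)
open import Data.Empty using (⊥-elim)
open import Data.Fin using (Fin; zero; suc; _≟_)
open import Data.Fin.Patterns using (0F; 1F; 2F; 3F)
open import Data.Fin.Properties using (0≢1+n; suc-injective; injective⇒≤; +↔⊎; *↔×; 2↔Bool)
open import Data.List.Properties using (map-tabulate)
open import Data.Nat using (ℕ; suc; _+_; _*_; _%_; _≤_; _<_; _⊔_; z≤n)
open import Data.Nat.Induction using (<-rec)
open import Data.Nat.ListAction using (sum)
open import Data.Nat.Properties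
  using (≤-refl; ≤-trans; ≤-pred; ≮⇒≥; 1+n≰n; m≤n⇒m<n∨m≡n; m≤m⊔n; m≤n⊔m; module ≤-Reasoning)
open import Data.Product using (Σ; ∃; _×_; _,_; proj₁; uncurry)
open import Data.Product.Function.NonDependent.Propositional using (_×-↔_)
open import Data.Sum using (_⊎_; inj₁; inj₂; [_,_]′)
import Data.Sum as Sum
open import Data.Sum.Function.Propositional using (_⊎-↔_)
open import Function using (id; _∘_; case_of_)
open import Function.Bundles using (_↔_; Inverse)
open import Function.Properties.Inverse using (↔-refl; ↔-trans)
open import Relation.Binary.PropositionalEquality as ≡
  using (_≡_; _≢_; refl; cong; cong₂; ≡-≟-identity)
open import Relation.Nullary using (¬_; yes; no)
open import Relation.Nullary.Decidable using (⌊_⌋)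

open import Defs

≟-true⇒≡ : ∀ {m} {x y : Fin m} → ⌊ x ≟ y ⌋ ≡ true → x ≡ y
≟-true⇒≡ {x = x} {y} e with x ≟ y | e
... | yes x≡y | _ = x≡y

≟-refl : ∀ {m} (x : Fin m) → ⌊ x ≟ x ⌋ ≡ true
≟-refl x rewrite ≡-≟-identity _≟_ (refl {x = x}) = refl

≟-sym : ∀ {m} (x y : Fin m) → ⌊ x ≟ y ⌋ ≡ ⌊ y ≟ x ⌋
≟-sym x y with x ≟ y | y ≟ x
... | yes _   | yes _   = refl
... | no _    | no _    = refl
... | yes x≡y | no y≢x  = ⊥-elim (y≢x (≡.sym x≡y))
... | no x≢y  | yes y≡x = ⊥-elim (x≢y (≡.sym y≡x))

-- χ_o and χ_so exist only up to double negation constructively; this suffices, as the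
-- theorem is a negation.
¬¬-least : (P : ℕ → Set) {k : ℕ} → P k → ¬ ¬ (∃ λ m → P m × (∀ t → P t → m ≤ t))
¬¬-least P {k} pk no-least = <-rec (λ t → ¬ P t) none-below k pk
  where
  none-below : ∀ t → (∀ {s} → s < t → ¬ P s) → ¬ P t
  none-below t below pt = no-least (t , pt , λ s ps → ≮⇒≥ λ s<t → below s<t ps)

prefixMax : (ℕ → ℕ) → ℕ → ℕ
prefixMax f ℕ.zero  = f 0
prefixMax f (suc k) = prefixMax f k ⊔ f (suc k)

≤-prefixMax : ∀ f {a k} → a ≤ k → f a ≤ prefixMax f k
≤-prefixMax f {k = ℕ.zero} z≤n = ≤-refl
≤-prefixMax f {k = suc k} a≤1+k with m≤n⇒m<n∨m≡n a≤1+k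
... | inj₁ a<1+k = ≤-trans (≤-prefixMax f (≤-pred a<1+k)) (m≤m⊔n _ _)
... | inj₂ refl  = m≤n⊔m (prefixMax f k) (f (suc k))

count-suc : ∀ {n} (p : Fin (suc n) → Bool) →
            count (suc n) p ≡ (if p zero then 1 else 0) + count n (p ∘ suc)
count-suc p = cong (indicator zero +_) (cong sum (≡.trans (map-tabulate suc indicator)
                                              (≡.sym (map-tabulate id (indicator ∘ suc)))))
  where
  indicator : Fin _ → ℕ
  indicator u = if p u then 1 else 0

count≡0 : ∀ {n} (p : Fin n → Bool) → (∀ u → p u ≢ true) → count n p ≡ 0
count≡0 {ℕ.zero} p none = refl
count≡0 {suc n}  p none with p zero in p0 | count-suc p
... | true  | _ = ⊥-elim (none zero p0)
... | false | e = ≡.trans e (count≡0 (p ∘ suc) (none ∘ suc))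

count≡1 : ∀ {n} (p : Fin n → Bool) {a} → p a ≡ true → (∀ u → p u ≡ true → u ≡ a) →
          count n p ≡ 1
count≡1 {suc n} p {zero} pa only with count-suc p
... | e rewrite pa =
  ≡.trans e (cong suc (count≡0 (p ∘ suc) λ u pu → 0≢1+n (≡.sym (only (suc u) pu))))
count≡1 {suc n} p {suc a} pa only with p zero in p0 | count-suc p
... | true  | _ = ⊥-elim (0≢1+n (only zero p0))
... | false | e = ≡.trans e (count≡1 (p ∘ suc) pa (λ u pu → suc-injective (only (suc u) pu)))

count≡2 : ∀ {n} (p : Fin n → Bool) {a b} → a ≢ b → p a ≡ true → p b ≡ true →
          (∀ u → p u ≡ true → u ≡ a ⊎ u ≡ b) → count n p ≡ 2
count≡2 {suc n} p {zero}  {zero}  a≢b _  _  _ = ⊥-elim (a≢b refl)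
count≡2 {suc n} p {zero}  {suc b} _   pa pb only with count-suc p
... | e rewrite pa = ≡.trans e (cong suc (count≡1 (p ∘ suc) pb λ u pu →
                       [ (λ ()) , suc-injective ]′ (only (suc u) pu)))
count≡2 {suc n} p {suc a} {zero}  _   pa pb only with count-suc p
... | e rewrite pb = ≡.trans e (cong suc (count≡1 (p ∘ suc) pa λ u pu →
                       [ suc-injective , (λ ()) ]′ (only (suc u) pu)))
count≡2 {suc n} p {suc a} {suc b} a≢b pa pb only with p zero in p0 | count-suc p
... | true  | _ = ⊥-elim ([ 0≢1+n , 0≢1+n ]′ (only zero p0))
... | false | e = ≡.trans e (count≡2 (p ∘ suc) (a≢b ∘ cong suc) pa pb
                    λ u pu → Sum.map suc-injective suc-injective (only (suc u) pu))

module _ (G : Graph) {t : ℕ} (φ : Fin (n G) → Fin t) where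

  private
    coloured-neighbour : ∀ {v w i} → adj G v w ∧ ⌊ φ w ≟ i ⌋ ≡ true → adj G v w ≡ true × φ w ≡ i
    coloured-neighbour e = ∧-conicalˡ _ _ e , ≟-true⇒≡ (∧-conicalʳ _ _ e)

    neighbour-coloured : ∀ {v w i} → adj G v w ≡ true → φ w ≡ i → adj G v w ∧ ⌊ φ w ≟ i ⌋ ≡ true
    neighbour-coloured {w = w} vw refl rewrite vw = ≟-refl (φ w)

  nbColorCount≡0 : ∀ {v i} → (∀ w → adj G v w ≡ true → φ w ≢ i) → nbColorCount G φ v i ≡ 0
  nbColorCount≡0 none = count≡0 _ λ w e → uncurry (none w) (coloured-neighbour e)

  nbColorCount≡1 : ∀ {v u} → adj G v u ≡ true → (∀ w → adj G v w ≡ true → φ w ≡ φ u → w ≡ u) →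
                   nbColorCount G φ v (φ u) ≡ 1
  nbColorCount≡1 vu only =
    count≡1 _ (neighbour-coloured vu refl) λ w e → uncurry (only w) (coloured-neighbour e)

  nbColorCount≡2 : ∀ {v u u′} → u ≢ u′ → adj G v u ≡ true → adj G v u′ ≡ true → φ u′ ≡ φ u →
                   (∀ w → adj G v w ≡ true → φ w ≡ φ u → w ≡ u ⊎ w ≡ u′) →
                   nbColorCount G φ v (φ u) ≡ 2
  nbColorCount≡2 u≢u′ vu vu′ same only =
    count≡2 _ u≢u′ (neighbour-coloured vu refl) (neighbour-coloured vu′ same)
      λ w e → uncurry (only w) (coloured-neighbour e)

  strongOdd⇒nbColorCount≢2 : IsStrongOdd G φ → ∀ v i → nbColorCount G φ v i ≢ 2
  strongOdd⇒nbColorCount≢2 (_ , zero-or-odd) v i c≡2 with zero-or-odd v i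
  ... | inj₁ c≡0 = case ≡.trans (≡.sym c≡2) c≡0 of λ ()
  ... | inj₂ odd = case ≡.trans (≡.sym odd) (cong (_% 2) c≡2) of λ ()

identity-isStrongOdd : (G : Graph) → IsStrongOdd G id
identity-isStrongOdd G = proper , zero-or-one
  where
  proper : IsProper G id
  proper u .u uu refl = case ≡.trans (≡.sym uu) (irrefl G u) of λ ()

  zero-or-one : ∀ v i → nbColorCount G id v i ≡ 0 ⊎ IsOdd (nbColorCount G id v i)
  zero-or-one v i with adj G v i in vi
  ... | true  = inj₂ (≡.subst IsOdd (≡.sym (nbColorCount≡1 G id vi λ _ _ wi → wi)) refl)
  ... | false = inj₁ (nbColorCount≡0 G id λ { _ vw refl → case ≡.trans (≡.sym vw) vi of λ () })

fin*2↔×Bool : ∀ {m} → Fin (m * 2) ↔ (Fin m × Bool)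
fin*2↔×Bool = ↔-trans *↔× (↔-refl ×-↔ 2↔Bool)

module HubGraph (N : ℕ) where

  -- Pairs with x ≡ y are included so that the vertex set is a product; they do no harm.
  Vertex : Set
  Vertex = (Fin N × Bool) ⊎ (Fin N × Fin N × Bool)

  pattern hub x     = inj₁ (x , false)
  pattern leaf x    = inj₁ (x , true)
  pattern link x y  = inj₂ (x , y , false)
  pattern guard x y = inj₂ (x , y , true)

  _≡ᵇ_ : Fin N → Fin N → Bool
  x ≡ᵇ y = ⌊ x ≟ y ⌋

  ≡ᵇ∧≡ᵇ⇒≡ : ∀ {x y x′ y′} → (x ≡ᵇ x′) ∧ (y ≡ᵇ y′) ≡ true → x′ ≡ x × y′ ≡ y
  ≡ᵇ∧≡ᵇ⇒≡ e = ≡.sym (≟-true⇒≡ (∧-conicalˡ _ _ e)) , ≡.sym (≟-true⇒≡ (∧-conicalʳ _ _ e))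

  adjacent : Vertex → Vertex → Bool
  adjacent (inj₁ (x , i))     (inj₁ (y , j))       = (i xor j) ∧ (x ≡ᵇ y)
  adjacent (hub x)            (inj₂ (y , z , _))   = (x ≡ᵇ y) ∨ (x ≡ᵇ z)
  adjacent (leaf _)           (inj₂ _)             = false
  adjacent (inj₂ (y , z , _)) (hub x)              = (x ≡ᵇ y) ∨ (x ≡ᵇ z)
  adjacent (inj₂ _)           (leaf _)             = false
  adjacent (inj₂ (x , y , i)) (inj₂ (x′ , y′ , j)) = (i xor j) ∧ ((x ≡ᵇ x′) ∧ (y ≡ᵇ y′))

  adjacent-sym : ∀ s t → adjacent s t ≡ adjacent t s
  adjacent-sym (inj₁ (x , i))     (inj₁ (y , j))       = cong₂ _∧_ (xor-comm i j) (≟-sym x y)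
  adjacent-sym (hub _)            (inj₂ _)             = refl
  adjacent-sym (leaf _)           (inj₂ _)             = refl
  adjacent-sym (inj₂ _)           (hub _)              = refl
  adjacent-sym (inj₂ _)           (leaf _)             = refl
  adjacent-sym (inj₂ (x , y , i)) (inj₂ (x′ , y′ , j)) =
    cong₂ _∧_ (xor-comm i j) (cong₂ _∧_ (≟-sym x x′) (≟-sym y y′))

  adjacent-irrefl : ∀ s → adjacent s s ≡ false
  adjacent-irrefl (inj₁ (_ , i))     rewrite xor-same i = refl
  adjacent-irrefl (inj₂ (_ , _ , i)) rewrite xor-same i = refl

  colour : Vertex → Fin 4
  colour (hub _)     = 0F
  colour (link _ _)  = 1F
  colour (guard _ _) = 2F
  colour (leaf _)    = 3F

  colour-proper : ∀ s t → adjacent s t ≡ true → colour s ≢ colour t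
  colour-proper (hub _)     (hub _)     ()
  colour-proper (leaf _)    (leaf _)    ()
  colour-proper (link _ _)  (link _ _)  ()
  colour-proper (guard _ _) (guard _ _) ()
  colour-proper (hub _)     (link _ _)  _  ()
  colour-proper (hub _)     (guard _ _) _  ()
  colour-proper (link _ _)  (hub _)     _  ()
  colour-proper (link _ _)  (leaf _)    _  ()
  colour-proper (guard _ _) (hub _)     _  ()
  colour-proper (guard _ _) (leaf _)    _  ()

  partner : Vertex → Vertex
  partner (inj₁ (x , i))     = inj₁ (x , not i)
  partner (inj₂ (x , y , i)) = inj₂ (x , y , not i)

  adjacent-partner : ∀ s → adjacent s (partner s) ≡ true
  adjacent-partner (inj₁ (x , false))     = ≟-refl x
  adjacent-partner (inj₁ (x , true))      = ≟-refl x
  adjacent-partner (inj₂ (x , y , false)) = cong₂ _∧_ (≟-refl x) (≟-refl y)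
  adjacent-partner (inj₂ (x , y , true))  = cong₂ _∧_ (≟-refl x) (≟-refl y)

  partner-unique : ∀ s t → adjacent s t ≡ true → colour t ≡ colour (partner s) → t ≡ partner s
  partner-unique (hub x)     (leaf y)      e _ = cong leaf (≡.sym (≟-true⇒≡ e))
  partner-unique (leaf x)    (hub y)       e _ = cong hub (≡.sym (≟-true⇒≡ e))
  partner-unique (link x y)  (guard x′ y′) e _ = uncurry (cong₂ guard) (≡ᵇ∧≡ᵇ⇒≡ e)
  partner-unique (guard x y) (link x′ y′)  e _ = uncurry (cong₂ link) (≡ᵇ∧≡ᵇ⇒≡ e)
  partner-unique (hub _)     (link _ _)    _ ()
  partner-unique (hub _)     (guard _ _)   _ ()
  partner-unique (link _ _)  (hub _)       _ ()
  partner-unique (link _ _)  (leaf _)      _ ()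
  partner-unique (guard _ _) (hub _)       _ ()
  partner-unique (guard _ _) (leaf _)      _ ()

  link-neighbours : ∀ {x y} t → adjacent (link x y) t ≡ true →
                    t ≡ hub x ⊎ t ≡ hub y ⊎ t ≡ guard x y
  link-neighbours {x} {y} (hub z) e with z ≟ x | z ≟ y
  ... | yes refl | _        = inj₁ refl
  ... | no _     | yes refl = inj₂ (inj₁ refl)
  link-neighbours (guard x′ y′) e = inj₂ (inj₂ (uncurry (cong₂ guard) (≡ᵇ∧≡ᵇ⇒≡ e)))

  link∼hub₁ : ∀ x y → adjacent (link x y) (hub x) ≡ true
  link∼hub₁ x _ rewrite ≟-refl x = refl

  link∼hub₂ : ∀ x y → adjacent (link x y) (hub y) ≡ true
  link∼hub₂ _ y rewrite ≟-refl y = ∨-zeroʳ _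

  hub₁∼guard : ∀ x y → adjacent (hub x) (guard x y) ≡ true
  hub₁∼guard x _ rewrite ≟-refl x = refl

  M : ℕ
  M = N * 2 + N * (N * 2)

  enumeration : Fin M ↔ Vertex
  enumeration = ↔-trans +↔⊎ (fin*2↔×Bool ⊎-↔ ↔-trans *↔× (↔-refl ×-↔ fin*2↔×Bool))

  open Inverse enumeration using (to; from; strictlyInverseˡ; strictlyInverseʳ)

  hubGraph : Graph
  hubGraph = record
    { n      = M
    ; adj    = λ u v → adjacent (to u) (to v)
    ; sym    = λ u v → adjacent-sym (to u) (to v)
    ; irrefl = λ v → adjacent-irrefl (to v)
    }

  to≡⇒≡from : ∀ {u s} → to u ≡ s → u ≡ from s
  to≡⇒≡from {u} refl = ≡.sym (strictlyInverseʳ u)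

  from-injective : ∀ {s t} → from s ≡ from t → s ≡ t
  from-injective {s} {t} e =
    ≡.trans (≡.sym (strictlyInverseˡ s)) (≡.trans (cong to e) (strictlyInverseˡ t))

  adjacent⇒adj-from : ∀ s t → adjacent s t ≡ true → adj hubGraph (from s) (from t) ≡ true
  adjacent⇒adj-from s t e rewrite strictlyInverseˡ s | strictlyInverseˡ t = e

  adj-from⇒adjacent : ∀ s w → adj hubGraph (from s) w ≡ true → adjacent s (to w) ≡ true
  adj-from⇒adjacent s w = ≡.subst (λ s′ → adjacent s′ (to w) ≡ true) (strictlyInverseˡ s)

  nbColorCount-partner≡1 : ∀ v →
    nbColorCount hubGraph (colour ∘ to) v (colour (to (from (partner (to v))))) ≡ 1
  nbColorCount-partner≡1 v = nbColorCount≡1 hubGraph (colour ∘ to) v∼p only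
    where
    p : Vertex
    p = partner (to v)

    v∼p : adjacent (to v) (to (from p)) ≡ true
    v∼p rewrite strictlyInverseˡ p = adjacent-partner (to v)

    only : ∀ w → adjacent (to v) (to w) ≡ true → colour (to w) ≡ colour (to (from p)) → w ≡ from p
    only w v∼w same rewrite strictlyInverseˡ p = to≡⇒≡from (partner-unique (to v) (to w) v∼w same)

  hubGraph-oddColoring : HasOddColoring hubGraph 4
  hubGraph-oddColoring =
    colour ∘ to ,
    (λ u v → colour-proper (to u) (to v)) ,
    λ v _ → _ , ≡.subst IsOdd (≡.sym (nbColorCount-partner≡1 v)) refl

  module _ {t : ℕ} {φ : Fin M → Fin t} (strongOdd : IsStrongOdd hubGraph φ) where

    link-neighbour-of-hub-colour : ∀ {x y} w → adj hubGraph (from (link x y)) w ≡ true →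
                                   φ w ≡ φ (from (hub x)) → w ≡ from (hub x) ⊎ w ≡ from (hub y)
    link-neighbour-of-hub-colour {x} {y} w link∼w same
      with link-neighbours (to w) (adj-from⇒adjacent (link x y) w link∼w)
    ... | inj₁ w≡hub₁        = inj₁ (to≡⇒≡from w≡hub₁)
    ... | inj₂ (inj₁ w≡hub₂) = inj₂ (to≡⇒≡from w≡hub₂)
    ... | inj₂ (inj₂ w≡guard) =
      ⊥-elim (proj₁ strongOdd (from (hub x)) (from (guard x y))
                (adjacent⇒adj-from (hub x) (guard x y) (hub₁∼guard x y))
                (≡.trans (≡.sym same) (cong φ (to≡⇒≡from w≡guard))))

    hubs-coloured-apart : ∀ {x y} → x ≢ y → φ (from (hub x)) ≢ φ (from (hub y))
    hubs-coloured-apart {x} {y} x≢y same =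
      strongOdd⇒nbColorCount≢2 hubGraph φ strongOdd (from (link x y)) _
        (nbColorCount≡2 hubGraph φ hubs-distinct
          (adjacent⇒adj-from (link x y) (hub x) (link∼hub₁ x y))
          (adjacent⇒adj-from (link x y) (hub y) (link∼hub₂ x y))
          (≡.sym same) link-neighbour-of-hub-colour)
      where
      hubs-distinct : from (hub x) ≢ from (hub y)
      hubs-distinct e with from-injective {hub x} {hub y} e
      ... | refl = x≢y refl

  hubGraph-strongOdd⇒N≤ : ∀ {t} → HasStrongOddColoring hubGraph t → N ≤ t
  hubGraph-strongOdd⇒N≤ (φ , strongOdd) = injective⇒≤ hubColour-injective
    where
    hubColour-injective : ∀ {x y} → φ (from (hub x)) ≡ φ (from (hub y)) → x ≡ y
    hubColour-injective {x} {y} same with x ≟ y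
    ... | yes x≡y = x≡y
    ... | no x≢y  = ⊥-elim (hubs-coloured-apart strongOdd x≢y same)

mainTheorem1 : ¬ (Σ (ℕ → ℕ) λ f → ∀ (G : Graph) (a b : ℕ) →
    IsOddChromaticNumber G a → IsStrongOddChromaticNumber G b → b ≤ f a)
mainTheorem1 (f , χso≤f[χo]) =
  ¬¬-least (HasOddColoring hubGraph) hubGraph-oddColoring λ (a , odd-a , least-a) →
  ¬¬-least (HasStrongOddColoring hubGraph) (id , identity-isStrongOdd hubGraph)
    λ (b , strong-b , least-b) →
  1+n≰n (begin
    suc S ≤⟨ hubGraph-strongOdd⇒N≤ strong-b ⟩
    b     ≤⟨ χso≤f[χo] hubGraph a b (odd-a , least-a) (strong-b , least-b) ⟩
    f a   ≤⟨ ≤-prefixMax f (least-a 4 hubGraph-oddColoring) ⟩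
    S     ∎)
  where
  S : ℕ
  S = prefixMax f 4
  open HubGraph (suc S)
  open ≤-Reasoning
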